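{- Let $G$ be the graph with vertex set $\{a_0, p, q, r, i_1, i_2, \theta\}$ (7 distinct vertices) and edge set $\{a_0p,\ pi_1,\ pq,\ i_1q,\ i_1\theta,\ qr,\ \theta r,\ i_2\theta,\ i_2r\}$. Then $(G, a_0, (i_1,i_2), \theta)$ implements the Boolean NAND operation: for every assignment of colors in $\{0,1,2\}$ to $i_1, i_2$ there exists a proper 3-coloring $c$ of $G$ with $c(a_0)=0$ extending it, and in every proper 3-coloring $c$ of $G$ with $c(a_0)=0$ we have $c(\theta)=0$ if and only if $c(i_1)\neq 0$ and $c(i_2)\neq 0$.
   Context: Single anchor system for 3-coloring: a distinguished anchor vertex $a_0$ is fixed to color $0$, which represents logical false; colors $1$ and $2$ both represent logical true. A vertex $v$ has Boolean value $0$ iff $c(v)=0$ and Boolean value $1$ iff $c(v)\in\{1,2\}$. A proper 3-coloring is a map $c:V\to\{0,1,2\}$ with distinct colors on adjacent vertices. Implementing a Boolean function $\varphi$ means: every color assignment to the inputs extends to a proper 3-coloring with $c(a_0)=0$, and in every such coloring the Boolean value of $\theta$ equals $\varphi$ of the Boolean values of the inputs. -}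

module Defs where

open import Data.Fin using (Fin; zero)
open import Data.Product using (_×_; Σ)
open import Relation.Binary.PropositionalEquality using (_≡_; _≢_)
open import Function.Bundles using (_⇔_)

data V : Set where
  a₀ p q r i₁ i₂ θ : V

-- The (undirected) edge set of G, listed in one orientation:
-- {a₀p, pi₁, pq, i₁q, i₁θ, qr, θr, i₂θ, i₂r}
data E : V → V → Set where
  a₀p : E a₀ p
  pi₁ : E p i₁
  pq  : E p q
  i₁q : E i₁ q
  i₁θ : E i₁ θ
  qr  : E q r
  θr  : E θ r
  i₂θ : E i₂ θ
  i₂r : E i₂ r

data Adj : V → V → Set where
  fwd : ∀ {u v} → E u v → Adj u v
  bwd : ∀ {u v} → E u v → Adj v u

Coloring : Set
Coloring = V → Fin 3

Proper : Coloring → Set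
Proper c = ∀ {u v} → Adj u v → c u ≢ c v

-- proper 3-coloring with the anchor a₀ colored 0 (logical false)
Anchored : Coloring → Set
Anchored c = Proper c × c a₀ ≡ zero

{-# OPTIONS --safe #-}
module Submission where

-- The anchor forces p to be true.  If i₁ is true as well, the triangle p i₁ q
-- forces q to false, hence r to true; if moreover i₂ is true, the triangle
-- i₂ r θ forces θ to false.  Conversely θ false makes its neighbours i₁ and
-- i₂ true.  That every input pair extends is a table of nine colorings.

open import Defs
open import Data.Fin using (Fin; zero; _≟_)
open import Data.Fin.Patterns using (0F; 1F; 2F)
open import Data.Fin.Properties using (all?)
open import Data.Product using (_×_; Σ; _,_)
open import Data.Unit using (tt)
open import Function.Bundles using (_⇔_; mk⇔)
open import Relation.Binary.PropositionalEquality using (_≡_; _≢_; refl; sym; trans; ≢-sym)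
open import Relation.Nullary using (Dec; ¬?; contradiction)
open import Relation.Nullary.Decidable using (_×-dec_; map′; toWitness)

third-of-triangle≡0 : {x y z : Fin 3} →
  x ≢ 0F → y ≢ 0F → x ≢ y → x ≢ z → y ≢ z → z ≡ 0F
third-of-triangle≡0 {z = 0F} _ _ _ _ _ = refl
third-of-triangle≡0 {0F} x≢0 _ _ _ _ = contradiction refl x≢0
third-of-triangle≡0 {_} {0F} _ y≢0 _ _ _ = contradiction refl y≢0
third-of-triangle≡0 {1F} {1F} _ _ x≢y _ _ = contradiction refl x≢y
third-of-triangle≡0 {2F} {2F} _ _ x≢y _ _ = contradiction refl x≢y
third-of-triangle≡0 {1F} {2F} {1F} _ _ _ x≢z _ = contradiction refl x≢z
third-of-triangle≡0 {1F} {2F} {2F} _ _ _ _ y≢z = contradiction refl y≢z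
third-of-triangle≡0 {2F} {1F} {1F} _ _ _ _ y≢z = contradiction refl y≢z
third-of-triangle≡0 {2F} {1F} {2F} _ _ _ x≢z _ = contradiction refl x≢z

module _ {c : Coloring} (proper : Proper c) where

  neighbour-of-0≢0 : ∀ {u v} → Adj u v → c u ≡ 0F → c v ≢ 0F
  neighbour-of-0≢0 uv cu≡0 cv≡0 = proper uv (trans cu≡0 (sym cv≡0))

  triangle-apex≡0 : ∀ {u v w} → Adj u v → Adj u w → Adj v w →
    c u ≢ 0F → c v ≢ 0F → c w ≡ 0F
  triangle-apex≡0 uv uw vw cu≢0 cv≢0 =
    third-of-triangle≡0 cu≢0 cv≢0 (proper uv) (proper uw) (proper vw)

θ-computes-nand : (c : Coloring) → Anchored c →
  (c θ ≡ 0F ⇔ (c i₁ ≢ 0F × c i₂ ≢ 0F))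
θ-computes-nand c (proper , a₀≡0) = mk⇔ inputs-true θ≡0
  where
  inputs-true : c θ ≡ 0F → c i₁ ≢ 0F × c i₂ ≢ 0F
  inputs-true θ≡0 =
    neighbour-of-0≢0 proper (bwd i₁θ) θ≡0 , neighbour-of-0≢0 proper (bwd i₂θ) θ≡0

  θ≡0 : c i₁ ≢ 0F × c i₂ ≢ 0F → c θ ≡ 0F
  θ≡0 (i₁≢0 , i₂≢0) = triangle-apex≡0 proper (fwd i₂r) (fwd i₂θ) (bwd θr) i₂≢0 r≢0
    where
    p≢0 : c p ≢ 0F
    p≢0 = neighbour-of-0≢0 proper (fwd a₀p) a₀≡0

    q≡0 : c q ≡ 0F
    q≡0 = triangle-apex≡0 proper (fwd pi₁) (fwd pq) (fwd i₁q) p≢0 i₁≢0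

    r≢0 : c r ≢ 0F
    r≢0 = neighbour-of-0≢0 proper (fwd qr) q≡0

DistinctAlongEdges : Coloring → Set
DistinctAlongEdges c =
  c a₀ ≢ c p × c p ≢ c i₁ × c p ≢ c q × c i₁ ≢ c q × c i₁ ≢ c θ ×
  c q ≢ c r × c θ ≢ c r × c i₂ ≢ c θ × c i₂ ≢ c r

distinct-along-edge : ∀ {c u v} → DistinctAlongEdges c → E u v → c u ≢ c v
distinct-along-edge (h , _) a₀p = h
distinct-along-edge (_ , h , _) pi₁ = h
distinct-along-edge (_ , _ , h , _) pq = h
distinct-along-edge (_ , _ , _ , h , _) i₁q = h
distinct-along-edge (_ , _ , _ , _ , h , _) i₁θ = h
distinct-along-edge (_ , _ , _ , _ , _ , h , _) qr = h
distinct-along-edge (_ , _ , _ , _ , _ , _ , h , _) θr = h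
distinct-along-edge (_ , _ , _ , _ , _ , _ , _ , h , _) i₂θ = h
distinct-along-edge (_ , _ , _ , _ , _ , _ , _ , _ , h) i₂r = h

distinctAlongEdges⇒proper : ∀ {c} → DistinctAlongEdges c → Proper c
distinctAlongEdges⇒proper d (fwd e) = distinct-along-edge d e
distinctAlongEdges⇒proper d (bwd e) = ≢-sym (distinct-along-edge d e)

proper⇒distinctAlongEdges : ∀ {c} → Proper c → DistinctAlongEdges c
proper⇒distinctAlongEdges pr =
  pr (fwd a₀p) , pr (fwd pi₁) , pr (fwd pq) , pr (fwd i₁q) , pr (fwd i₁θ) ,
  pr (fwd qr) , pr (fwd θr) , pr (fwd i₂θ) , pr (fwd i₂r)

proper? : (c : Coloring) → Dec (Proper c)
proper? c = map′ distinctAlongEdges⇒proper proper⇒distinctAlongEdges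
  (c a₀ ≢? c p ×-dec c p ≢? c i₁ ×-dec c p ≢? c q ×-dec c i₁ ≢? c q ×-dec
   c i₁ ≢? c θ ×-dec c q ≢? c r ×-dec c θ ≢? c r ×-dec c i₂ ≢? c θ ×-dec c i₂ ≢? c r)
  where
  _≢?_ : (x y : Fin 3) → Dec (x ≢ y)
  x ≢? y = ¬? (x ≟ y)

Extends : Fin 3 → Fin 3 → Coloring → Set
Extends x₁ x₂ c = Anchored c × (c i₁ ≡ x₁ × c i₂ ≡ x₂)

extends? : (x₁ x₂ : Fin 3) (c : Coloring) → Dec (Extends x₁ x₂ c)
extends? x₁ x₂ c = (proper? c ×-dec c a₀ ≟ 0F) ×-dec (c i₁ ≟ x₁ ×-dec c i₂ ≟ x₂)

gadgetColoring : (x₁ x₂ xp xq xr xθ : Fin 3) → Coloring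
gadgetColoring x₁ x₂ xp xq xr xθ = λ where
  a₀ → 0F
  i₁ → x₁
  i₂ → x₂
  p  → xp
  q  → xq
  r  → xr
  θ  → xθ

extension : Fin 3 → Fin 3 → Coloring
extension 0F 0F = gadgetColoring 0F 0F 1F 2F 1F 2F
extension 0F 1F = gadgetColoring 0F 1F 1F 2F 0F 2F
extension 0F 2F = gadgetColoring 0F 2F 1F 2F 0F 1F
extension 1F 0F = gadgetColoring 1F 0F 2F 0F 1F 2F
extension 1F 1F = gadgetColoring 1F 1F 2F 0F 2F 0F
extension 1F 2F = gadgetColoring 1F 2F 2F 0F 1F 0F
extension 2F 0F = gadgetColoring 2F 0F 1F 0F 2F 1F
extension 2F 1F = gadgetColoring 2F 1F 1F 0F 2F 0F
extension 2F 2F = gadgetColoring 2F 2F 1F 0F 1F 0F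

extension-extends : (x₁ x₂ : Fin 3) → Extends x₁ x₂ (extension x₁ x₂)
extension-extends =
  toWitness {a? = all? λ x₁ → all? λ x₂ → extends? x₁ x₂ (extension x₁ x₂)} tt

mainTheorem2 : ((x₁ x₂ : Fin 3) → Σ Coloring (λ c → Anchored c × (c i₁ ≡ x₁ × c i₂ ≡ x₂)))
    × ((c : Coloring) → Anchored c → (c θ ≡ zero ⇔ (c i₁ ≢ zero × c i₂ ≢ zero)))
mainTheorem2 = (λ x₁ x₂ → extension x₁ x₂ , extension-extends x₁ x₂) , θ-computes-nand
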